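{- Let $G$ be an $r$-regular simple graph on $n$ vertices, where $n$ is even and $r \geq n/2$. If $G$ contains the complete graph $K_{n/2}$ as a subgraph, then for every integer $r'$ with $r \le r' \leq n-1$, $G$ can be extended to an $r'$-regular graph on $n$ vertices, i.e., there is a set $F$ of edges of the complement $G^c$ such that $(V(G), E(G)\cup F)$ is $r'$-regular.
   Context: All graphs are finite and simple. Extending a regular graph means adding edges (not already present), keeping the same vertex set, so that the resulting graph is regular of the prescribed higher degree. -}

module Defs where

open import Data.Nat using (ℕ; _+_)
open import Data.Bool using (Bool; true; false)
open import Data.Fin using (Fin)
open import Relation.Binary.PropositionalEquality using (_≡_; _≢_)
open import Data.List using (List; length; filter)
open import Data.List using () renaming (allFin to allFinL)
open import Data.Bool using (T)
open import Data.Bool.Properties using (T?)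
open import Function.Definitions using (Injective)

record Graph (n : ℕ) : Set where
  field
    adj   : Fin n → Fin n → Bool
    sym   : ∀ u v → adj u v ≡ adj v u
    irrefl : ∀ v → adj v v ≡ false
open Graph public

Adj : ∀ {n} → Graph n → Fin n → Fin n → Set
Adj G u v = T (adj G u v)

degree : ∀ {n} → Graph n → Fin n → ℕ
degree G v = length (filter (λ w → T? (adj G v w)) (allFinL _))

Regular : ∀ {n} → ℕ → Graph n → Set
Regular r G = ∀ v → degree G v ≡ r

ContainsComplete : ∀ {n} → ℕ → Graph n → Set
ContainsComplete {n} m G =
  Σ (Fin m → Fin n) λ f → Injective _≡_ _≡_ f × (∀ i j → i ≢ j → Adj G (f i) (f j))
  where open import Data.Product using (Σ; _×_)

-- H is obtained from G by adding edges: same vertex set, E(G) ⊆ E(H)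
-- (so E(H) = E(G) ∪ F with F = E(H) \ E(G) a set of edges of the complement of G)
Extends : ∀ {n} → Graph n → Graph n → Set
Extends G H = ∀ u v → Adj G u v → Adj H u v

-- It suffices to raise the degree by one while r + 1 ≤ n - 1, keeping the clique f : K_k ↪ G. The complement
-- of G is d-regular with d = n - 1 - r ≥ 1, and the complement neighbours of each clique vertex f i lie outside
-- the clique. Every vertex lies in at most d of these k neighbourhoods, each of size d, so double counting gives
-- Hall's condition and an injective σ choosing a complement neighbour σ i of each f i. The images of f and σ are
-- disjoint of size k, hence partition the n = 2k vertices, so the pairs {f i , σ i} form a perfect matching of
-- the complement; adding it raises every degree by one. Hall's theorem is proved by Rado's argument: while some
-- set of the family has two elements, one of them can be deleted without breaking Hall's condition.

module Submission where

open import Defs hiding (sym)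
open import Data.Nat
  using (ℕ; zero; suc; _+_; _*_; _≤_; _<_; _∸_; z≤n; s≤s; _≤′_; ≤′-reflexive; ≤′-step; NonZero; >-nonZero)
open import Data.Nat.Properties
  using ( ≤-refl; ≤-trans; <-trans; ≤-pred; n≤1+n; <⇒≱; ≮⇒≥; >⇒≢; n≮n; _<?_; ≤⇒≤′; module ≤-Reasoning
        ; +-comm; +-suc; +-identityʳ; *-identityˡ; +-mono-≤; +-monoʳ-≤; +-monoʳ-<; *-cancelʳ-≤
        ; m+n∸m≡n; m<n⇒0<n∸m; +-*-semiring )
open import Data.Bool using (Bool; true; false; _∧_; _∨_; not; T)
open import Data.Bool.Properties using (T?; T-∧; T-∨; T-≡; T-not-≡; ∧-identityʳ; ∧-zeroʳ)
open import Data.Fin using (Fin; zero; suc; _≟_)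
open import Data.Fin.Properties using (any?; suc-injective)
open import Data.List using (length; filter; tabulate)
import Data.Vec as Vec
import Data.Vec.Properties as Vec
open import Data.Fin.Subset.Properties using (anySubset?)
open import Data.Product using (Σ; ∃; ∃₂; _×_; _,_; proj₁; proj₂)
open import Data.Sum using (_⊎_; inj₁; inj₂)
import Data.Sum as Sum
open import Function using (_∘_; Equivalence; mk⇔)
open import Function.Definitions using (Injective)
open import Relation.Nullary using (¬_; Dec; yes; no; contradiction)
open import Relation.Nullary.Decidable
  using (⌊_⌋; isYes≗does; does-⇔; toWitness; fromWitness; toWitnessFalse; fromWitnessFalse)
open import Relation.Binary.PropositionalEquality
open import Algebra.Properties.Semiring.Sum +-*-semiring
  using (sum; sum-syntax; sum-cong-≗; sum-replicate-zero; ∑-distrib-+; ∑-comm; *-distribˡ-sum; *-distribʳ-sum)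

private variable m n N k r : ℕ

infix  4 _∈_ _∉_ _⊆_
infixr 6 _∪_
infixr 7 _∩_
infixl 8 _-_

FinSet : ℕ → Set
FinSet N = Fin N → Bool

_∈_ : Fin N → FinSet N → Set
x ∈ p = T (p x)

_∉_ : Fin N → FinSet N → Set
x ∉ p = ¬ x ∈ p

_⊆_ : FinSet N → FinSet N → Set
p ⊆ q = ∀ x → x ∈ p → x ∈ q

_∪_ _∩_ : FinSet N → FinSet N → FinSet N
(p ∪ q) x = p x ∨ q x
(p ∩ q) x = p x ∧ q x

∁ : FinSet N → FinSet N
∁ p x = not (p x)

⁅_⁆ : Fin N → FinSet N
⁅ a ⁆ x = ⌊ x ≟ a ⌋

_-_ : FinSet N → Fin N → FinSet N
p - a = p ∩ ∁ ⁅ a ⁆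

χ : Bool → ℕ
χ true  = 1
χ false = 0

∣_∣ : FinSet N → ℕ
∣_∣ {N} p = ∑[ x < N ] χ (p x)

∑-mono-≤ : {f g : Fin N → ℕ} → (∀ i → f i ≤ g i) → sum f ≤ sum g
∑-mono-≤ {zero}  _   = z≤n
∑-mono-≤ {suc N} f≤g = +-mono-≤ (f≤g zero) (∑-mono-≤ (f≤g ∘ suc))

∑-zero : {f : Fin N → ℕ} → (∀ i → f i ≡ 0) → sum f ≡ 0
∑-zero {N} f≡0 = trans (sum-cong-≗ f≡0) (sum-replicate-zero N)

∑-single : {f : Fin N → ℕ} (i : Fin N) → (∀ j → j ≢ i → f j ≡ 0) → sum f ≡ f i
∑-single {suc N} {f} zero f≡0 = begin
  f zero + sum (f ∘ suc) ≡⟨ cong (f zero +_) (∑-zero (λ j → f≡0 (suc j) λ ())) ⟩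
  f zero + 0             ≡⟨ +-identityʳ (f zero) ⟩
  f zero                 ∎
  where open ≡-Reasoning
∑-single {suc N} {f} (suc i) f≡0 = begin
  f zero + sum (f ∘ suc) ≡⟨ cong (_+ sum (f ∘ suc)) (f≡0 zero λ ()) ⟩
  sum (f ∘ suc)          ≡⟨ ∑-single i (λ j j≢i → f≡0 (suc j) (j≢i ∘ suc-injective)) ⟩
  f (suc i)              ∎
  where open ≡-Reasoning

T-not⁺ : ∀ {b} → ¬ T b → T (not b)
T-not⁺ {false} _  = _
T-not⁺ {true}  ¬t = ¬t _

T-not⁻ : ∀ {b} → T (not b) → ¬ T b
T-not⁻ {false} _ ()

⌊⌋-⇔ : ∀ {a b} {A : Set a} {B : Set b} → (A → B) → (B → A) → (a? : Dec A) (b? : Dec B) → ⌊ a? ⌋ ≡ ⌊ b? ⌋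
⌊⌋-⇔ A⇒B B⇒A a? b? = trans (isYes≗does a?) (trans (does-⇔ (mk⇔ A⇒B B⇒A) a? b?) (sym (isYes≗does b?)))

χ-true : ∀ {b} → T b → χ b ≡ 1
χ-true {true} _ = refl

χ-false : ∀ {b} → ¬ T b → χ b ≡ 0
χ-false {false} _  = refl
χ-false {true}  ¬t = contradiction _ ¬t

χ-mono : ∀ {a b} → (T a → T b) → χ a ≤ χ b
χ-mono {false}         _   = z≤n
χ-mono {true}  {true}  _   = ≤-refl
χ-mono {true}  {false} a⇒b = contradiction _ a⇒b

χ-∧ : ∀ a b → χ (a ∧ b) ≡ χ a * χ b
χ-∧ false _ = refl
χ-∧ true  b = sym (+-identityʳ (χ b))

x∈p∩q⁺ : (p q : FinSet N) {x : Fin N} → x ∈ p × x ∈ q → x ∈ p ∩ q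
x∈p∩q⁺ p q = Equivalence.from T-∧

x∈p∩q⁻ : (p q : FinSet N) {x : Fin N} → x ∈ p ∩ q → x ∈ p × x ∈ q
x∈p∩q⁻ p q = Equivalence.to T-∧

x∈p∪q⁺ : (p q : FinSet N) {x : Fin N} → x ∈ p ⊎ x ∈ q → x ∈ p ∪ q
x∈p∪q⁺ p q = Equivalence.from T-∨

x∈p∪q⁻ : (p q : FinSet N) {x : Fin N} → x ∈ p ∪ q → x ∈ p ⊎ x ∈ q
x∈p∪q⁻ p q = Equivalence.to T-∨

x∈⁅x⁆ : (x : Fin N) → x ∈ ⁅ x ⁆
x∈⁅x⁆ x = fromWitness refl

x∈⁅y⁆⇒x≡y : ∀ {x y : Fin N} → x ∈ ⁅ y ⁆ → x ≡ y
x∈⁅y⁆⇒x≡y = toWitness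

∣∣-cong : {p q : FinSet N} → (∀ x → p x ≡ q x) → ∣ p ∣ ≡ ∣ q ∣
∣∣-cong p≗q = sum-cong-≗ (cong χ ∘ p≗q)

p⊆q⇒∣p∣≤∣q∣ : {p q : FinSet N} → p ⊆ q → ∣ p ∣ ≤ ∣ q ∣
p⊆q⇒∣p∣≤∣q∣ p⊆q = ∑-mono-≤ (λ x → χ-mono (p⊆q x))

empty⇒∣p∣≡0 : {p : FinSet N} → (∀ x → x ∉ p) → ∣ p ∣ ≡ 0
empty⇒∣p∣≡0 empty = ∑-zero (λ x → χ-false (empty x))

∣p∪q∣+∣p∩q∣≡∣p∣+∣q∣ : (p q : FinSet N) → ∣ p ∪ q ∣ + ∣ p ∩ q ∣ ≡ ∣ p ∣ + ∣ q ∣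
∣p∪q∣+∣p∩q∣≡∣p∣+∣q∣ {N} p q = begin
  ∣ p ∪ q ∣ + ∣ p ∩ q ∣                      ≡⟨ ∑-distrib-+ (χ ∘ (p ∪ q)) (χ ∘ (p ∩ q)) ⟨
  ∑[ x < N ] (χ ((p ∪ q) x) + χ ((p ∩ q) x)) ≡⟨ sum-cong-≗ (λ x → pointwise (p x) (q x)) ⟩
  ∑[ x < N ] (χ (p x) + χ (q x))             ≡⟨ ∑-distrib-+ (χ ∘ p) (χ ∘ q) ⟩
  ∣ p ∣ + ∣ q ∣                              ∎
  where
  open ≡-Reasoning
  pointwise : ∀ a b → χ (a ∨ b) + χ (a ∧ b) ≡ χ a + χ b
  pointwise true  true  = refl
  pointwise true  false = refl
  pointwise false b     = +-identityʳ (χ b)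

∣p∣≡∣p∩∁q∣+∣p∩q∣ : (p q : FinSet N) → ∣ p ∣ ≡ ∣ p ∩ ∁ q ∣ + ∣ p ∩ q ∣
∣p∣≡∣p∩∁q∣+∣p∩q∣ p q =
  trans (sum-cong-≗ (λ x → pointwise (p x) (q x))) (∑-distrib-+ (χ ∘ (p ∩ ∁ q)) (χ ∘ (p ∩ q)))
  where
  pointwise : ∀ a b → χ a ≡ χ (a ∧ not b) + χ (a ∧ b)
  pointwise true  true  = refl
  pointwise true  false = refl
  pointwise false b     = refl

∣p∣+∣∁p∣≡N : (p : FinSet N) → ∣ p ∣ + ∣ ∁ p ∣ ≡ N
∣p∣+∣∁p∣≡N {N} p =
  trans (sym (∑-distrib-+ (χ ∘ p) (χ ∘ ∁ p))) (trans (sum-cong-≗ (pointwise ∘ p)) (count-ones N))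
  where
  pointwise : ∀ a → χ a + χ (not a) ≡ 1
  pointwise true  = refl
  pointwise false = refl
  count-ones : ∀ n → ∑[ x < n ] 1 ≡ n
  count-ones zero    = refl
  count-ones (suc n) = cong suc (count-ones n)

∣p∩⁅a⁆∣≡χ[p[a]] : (p : FinSet N) (a : Fin N) → ∣ p ∩ ⁅ a ⁆ ∣ ≡ χ (p a)
∣p∩⁅a⁆∣≡χ[p[a]] p a = begin
  ∣ p ∩ ⁅ a ⁆ ∣      ≡⟨ ∑-single a (λ x x≢a → χ-false (x≢a ∘ x∈⁅y⁆⇒x≡y ∘ proj₂ ∘ x∈p∩q⁻ p ⁅ a ⁆)) ⟩
  χ (p a ∧ ⁅ a ⁆ a)  ≡⟨ cong (λ b → χ (p a ∧ b)) (Equivalence.to T-≡ (x∈⁅x⁆ a)) ⟩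
  χ (p a ∧ true)     ≡⟨ cong χ (∧-identityʳ (p a)) ⟩
  χ (p a)            ∎
  where open ≡-Reasoning

∣p∣≡∣p-a∣+χ[p[a]] : (p : FinSet N) (a : Fin N) → ∣ p ∣ ≡ ∣ p - a ∣ + χ (p a)
∣p∣≡∣p-a∣+χ[p[a]] p a = trans (∣p∣≡∣p∩∁q∣+∣p∩q∣ p ⁅ a ⁆) (cong (∣ p - a ∣ +_) (∣p∩⁅a⁆∣≡χ[p[a]] p a))

x∈p-y : (p : FinSet N) {x y : Fin N} → x ∈ p → x ≢ y → x ∈ p - y
x∈p-y p x∈p x≢y = Equivalence.from T-∧ (x∈p , fromWitnessFalse x≢y)

p-y[x]≡p[x] : (p : FinSet N) {x y : Fin N} → x ≢ y → (p - y) x ≡ p x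
p-y[x]≡p[x] p {x} x≢y =
  trans (cong (λ b → p x ∧ not b) (Equivalence.to T-not-≡ (fromWitnessFalse x≢y))) (∧-identityʳ (p x))

x∈p-y⇒x∈p : (p : FinSet N) {x y : Fin N} → x ∈ p - y → x ∈ p
x∈p-y⇒x∈p p = proj₁ ∘ Equivalence.to T-∧

x∈p-y⇒x≢y : (p : FinSet N) {x y : Fin N} → x ∈ p - y → x ≢ y
x∈p-y⇒x≢y p {x} {y} = toWitnessFalse {a? = x ≟ y} ∘ proj₂ ∘ Equivalence.to T-∧

full⇒∣p∣≡N : (p : FinSet N) → (∀ x → x ∈ p) → ∣ p ∣ ≡ N
full⇒∣p∣≡N {N} p full = begin
  ∣ p ∣             ≡⟨ +-identityʳ ∣ p ∣ ⟨
  ∣ p ∣ + 0         ≡⟨ cong (∣ p ∣ +_) (empty⇒∣p∣≡0 (λ x x∈∁p → T-not⁻ x∈∁p (full x))) ⟨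
  ∣ p ∣ + ∣ ∁ p ∣    ≡⟨ ∣p∣+∣∁p∣≡N p ⟩
  N                 ∎
  where open ≡-Reasoning

x∈p⇒∣p∣≡1+∣p-x∣ : (p : FinSet N) {x : Fin N} → x ∈ p → ∣ p ∣ ≡ suc ∣ p - x ∣
x∈p⇒∣p∣≡1+∣p-x∣ p {x} x∈p =
  trans (∣p∣≡∣p-a∣+χ[p[a]] p x) (trans (cong (∣ p - x ∣ +_) (χ-true x∈p)) (+-comm ∣ p - x ∣ 1))

x∈p⇒0<∣p∣ : (p : FinSet N) {x : Fin N} → x ∈ p → 0 < ∣ p ∣
x∈p⇒0<∣p∣ p x∈p = subst (0 <_) (sym (x∈p⇒∣p∣≡1+∣p-x∣ p x∈p)) (s≤s z≤n)

0<∣p∣⇒nonempty : (p : FinSet N) → 0 < ∣ p ∣ → ∃ (_∈ p)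
0<∣p∣⇒nonempty p 0<∣p∣ with any? (λ x → T? (p x))
... | yes x∈p = x∈p
... | no  ∄x  = contradiction (empty⇒∣p∣≡0 (λ x x∈p → ∄x (x , x∈p))) (>⇒≢ 0<∣p∣)

distinct⇒1<∣p∣ : (p : FinSet N) {x y : Fin N} → x ∈ p → y ∈ p → x ≢ y → 1 < ∣ p ∣
distinct⇒1<∣p∣ p x∈p y∈p x≢y =
  subst (1 <_) (sym (x∈p⇒∣p∣≡1+∣p-x∣ p x∈p)) (s≤s (x∈p⇒0<∣p∣ (p - _) (x∈p-y p y∈p (x≢y ∘ sym))))

1<∣p∣⇒distinct : (p : FinSet N) → 1 < ∣ p ∣ → ∃₂ λ x y → x ∈ p × y ∈ p × x ≢ y
1<∣p∣⇒distinct p 1<∣p∣ =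
  let x , x∈p   = 0<∣p∣⇒nonempty p (<-trans (s≤s z≤n) 1<∣p∣)
      y , y∈p-x = 0<∣p∣⇒nonempty (p - x) (≤-pred (subst (1 <_) (x∈p⇒∣p∣≡1+∣p-x∣ p x∈p) 1<∣p∣))
  in x , y , x∈p , x∈p-y⇒x∈p p y∈p-x , x∈p-y⇒x≢y p y∈p-x ∘ sym

∣p∣≤1⇒x≡y : (p : FinSet N) {x y : Fin N} → ∣ p ∣ ≤ 1 → x ∈ p → y ∈ p → x ≡ y
∣p∣≤1⇒x≡y p {x} {y} ∣p∣≤1 x∈p y∈p with x ≟ y
... | yes x≡y = x≡y
... | no  x≢y = contradiction ∣p∣≤1 (<⇒≱ (distinct⇒1<∣p∣ p x∈p y∈p x≢y))

∣p∘f∣≤∣p∣ : {f : Fin m → Fin N} → Injective _≡_ _≡_ f → (p : FinSet N) → ∣ p ∘ f ∣ ≤ ∣ p ∣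
∣p∘f∣≤∣p∣ {zero}          _     p = z≤n
∣p∘f∣≤∣p∣ {suc m} {f = f} f-inj p = begin
  χ (p (f zero)) + ∣ p ∘ f ∘ suc ∣
    ≡⟨ cong (χ (p (f zero)) +_) (∣∣-cong (λ i → p-y[x]≡p[x] p {f (suc i)} ((λ ()) ∘ f-inj))) ⟨
  χ (p (f zero)) + ∣ (p - f zero) ∘ f ∘ suc ∣
    ≤⟨ +-monoʳ-≤ (χ (p (f zero))) (∣p∘f∣≤∣p∣ (suc-injective ∘ f-inj) (p - f zero)) ⟩
  χ (p (f zero)) + ∣ p - f zero ∣
    ≡⟨ +-comm (χ (p (f zero))) ∣ p - f zero ∣ ⟩
  ∣ p - f zero ∣ + χ (p (f zero))
    ≡⟨ ∣p∣≡∣p-a∣+χ[p[a]] p (f zero) ⟨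
  ∣ p ∣ ∎
  where open ≤-Reasoning

∣⁅a⁆∣≡1 : (a : Fin N) → ∣ ⁅ a ⁆ ∣ ≡ 1
∣⁅a⁆∣≡1 a = ∣p∩⁅a⁆∣≡χ[p[a]] (λ _ → true) a

Family : ℕ → ℕ → Set
Family m N = Fin m → FinSet N

⋃ : Family m N → FinSet m → FinSet N
⋃ A I x = ⌊ any? (λ i → T? (I i ∧ A i x)) ⌋

module _ (A : Family m N) (I : FinSet m) where

  ∈⋃⁺ : ∀ {i x} → i ∈ I → x ∈ A i → x ∈ ⋃ A I
  ∈⋃⁺ i∈I x∈Ai = fromWitness (_ , Equivalence.from T-∧ (i∈I , x∈Ai))

  ∈⋃⁻ : ∀ {x} → x ∈ ⋃ A I → ∃ λ i → i ∈ I × x ∈ A i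
  ∈⋃⁻ x∈⋃ = let i , i∈I∩x∈Ai = toWitness x∈⋃ in i , Equivalence.to T-∧ i∈I∩x∈Ai

⋃-mono : (A : Family m N) {I J : FinSet m} → I ⊆ J → ⋃ A I ⊆ ⋃ A J
⋃-mono A {I} {J} I⊆J x x∈⋃AI = let i , i∈I , x∈Ai = ∈⋃⁻ A I x∈⋃AI in ∈⋃⁺ A J (I⊆J i i∈I) x∈Ai

HallCondition : Family m N → Set
HallCondition {m} A = (I : FinSet m) → ∣ I ∣ ≤ ∣ ⋃ A I ∣

Transversal : Family m N → Set
Transversal {m} {N} A = Σ (Fin m → Fin N) λ σ → (∀ i → σ i ∈ A i) × Injective _≡_ _≡_ σ

hallCondition-or-violator : (A : Family m N) → HallCondition A ⊎ ∃ λ I → ∣ ⋃ A I ∣ < ∣ I ∣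
hallCondition-or-violator A with anySubset? (λ v → ∣ ⋃ A (Vec.lookup v) ∣ <? ∣ Vec.lookup v ∣)
... | yes (v , violated) = inj₂ (Vec.lookup v , violated)
... | no  ∄violator     = inj₁ λ I → ≮⇒≥ (∄violator ∘ (Vec.tabulate I ,_) ∘ violated-tabulated I)
  where
  violated-tabulated : ∀ I → ∣ ⋃ A I ∣ < ∣ I ∣ →
                       ∣ ⋃ A (Vec.lookup (Vec.tabulate I)) ∣ < ∣ Vec.lookup (Vec.tabulate I) ∣
  violated-tabulated I violated = begin-strict
    ∣ ⋃ A (Vec.lookup (Vec.tabulate I)) ∣ ≤⟨ p⊆q⇒∣p∣≤∣q∣ (⋃-mono A (λ i → subst T (Vec.lookup∘tabulate I i))) ⟩
    ∣ ⋃ A I ∣                            <⟨ violated ⟩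
    ∣ I ∣                                ≡⟨ ∣∣-cong (Vec.lookup∘tabulate I) ⟨
    ∣ Vec.lookup (Vec.tabulate I) ∣      ∎
    where open ≤-Reasoning

⁅_↦_⁆ : Fin m → Fin N → Family m N
⁅ i ↦ x ⁆ j y = ⌊ j ≟ i ⌋ ∧ ⌊ y ≟ x ⌋

_∖[_,_] : Family m N → Fin m → Fin N → Family m N
(A ∖[ i , x ]) j = A j ∩ ∁ (⁅ i ↦ x ⁆ j)

module _ (A : Family m N) (i : Fin m) where

  ∖-⊆ : ∀ x j → (A ∖[ i , x ]) j ⊆ A j
  ∖-⊆ x j y = proj₁ ∘ x∈p∩q⁻ (A j) (∁ (⁅ i ↦ x ⁆ j))

  ∈∖⁺ : ∀ x {j y} → y ∈ A j → j ≢ i ⊎ y ≢ x → y ∈ (A ∖[ i , x ]) j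
  ∈∖⁺ x {j} {y} y∈Aj j≢i⊎y≢x =
    x∈p∩q⁺ (A j) (∁ (⁅ i ↦ x ⁆ j)) (y∈Aj , T-not⁺ (not-deleted j≢i⊎y≢x ∘ Equivalence.to T-∧))
    where
    not-deleted : j ≢ i ⊎ y ≢ x → ¬ (T ⌊ j ≟ i ⌋ × T ⌊ y ≟ x ⌋)
    not-deleted (inj₁ j≢i) (j≡i , _) = j≢i (toWitness j≡i)
    not-deleted (inj₂ y≢x) (_ , y≡x) = y≢x (toWitness y≡x)

  ⋃[I∪J]⊆⋃∖[I]∪⋃∖[J] : ∀ {x y I J} → x ≢ y → i ∈ I → i ∈ J →
                       ⋃ A (I ∪ J) ⊆ ⋃ (A ∖[ i , x ]) I ∪ ⋃ (A ∖[ i , y ]) J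
  ⋃[I∪J]⊆⋃∖[I]∪⋃∖[J] {x} {y} {I} {J} x≢y i∈I i∈J z z∈⋃ =
    let j , j∈I∪J , z∈Aj = ∈⋃⁻ A (I ∪ J) z∈⋃
    in  x∈p∪q⁺ (⋃ (A ∖[ i , x ]) I) (⋃ (A ∖[ i , y ]) J) (cover j∈I∪J z∈Aj (j ≟ i) (z ≟ x))
    where
    cover : ∀ {j} → j ∈ I ∪ J → z ∈ A j → Dec (j ≡ i) → Dec (z ≡ x) →
            z ∈ ⋃ (A ∖[ i , x ]) I ⊎ z ∈ ⋃ (A ∖[ i , y ]) J
    cover j∈I∪J z∈Aj (no j≢i) _ =
      Sum.map (λ j∈I → ∈⋃⁺ (A ∖[ i , x ]) I j∈I (∈∖⁺ x z∈Aj (inj₁ j≢i)))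
              (λ j∈J → ∈⋃⁺ (A ∖[ i , y ]) J j∈J (∈∖⁺ y z∈Aj (inj₁ j≢i)))
              (x∈p∪q⁻ I J j∈I∪J)
    cover _ z∈Ai (yes refl) (no z≢x)  = inj₁ (∈⋃⁺ (A ∖[ i , x ]) I i∈I (∈∖⁺ x z∈Ai (inj₂ z≢x)))
    cover _ z∈Ai (yes refl) (yes z≡x) = inj₂ (∈⋃⁺ (A ∖[ i , y ]) J i∈J (∈∖⁺ y z∈Ai (inj₂ (x≢y ∘ trans (sym z≡x)))))

  ⋃[I∩J-i]⊆⋃∖[I]∩⋃∖[J] : ∀ {x y I J} → ⋃ A ((I ∩ J) - i) ⊆ ⋃ (A ∖[ i , x ]) I ∩ ⋃ (A ∖[ i , y ]) J
  ⋃[I∩J-i]⊆⋃∖[I]∩⋃∖[J] {x} {y} {I} {J} z z∈⋃ =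
    let j , j∈I∩J-i , z∈Aj = ∈⋃⁻ A ((I ∩ J) - i) z∈⋃
        j∈I , j∈J = x∈p∩q⁻ I J (x∈p-y⇒x∈p (I ∩ J) j∈I∩J-i)
        j≢i       = x∈p-y⇒x≢y (I ∩ J) j∈I∩J-i
    in  x∈p∩q⁺ (⋃ (A ∖[ i , x ]) I) (⋃ (A ∖[ i , y ]) J)
               ( ∈⋃⁺ (A ∖[ i , x ]) I j∈I (∈∖⁺ x z∈Aj (inj₁ j≢i))
               , ∈⋃⁺ (A ∖[ i , y ]) J j∈J (∈∖⁺ y z∈Aj (inj₁ j≢i)))

size : Family m N → ℕ
size {m} A = ∑[ j < m ] ∣ A j ∣

size-∖ : (A : Family m N) {i : Fin m} {x : Fin N} → x ∈ A i → size A ≡ suc (size (A ∖[ i , x ]))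
size-∖ {m} {N} A {i} {x} x∈Ai = begin
  size A
    ≡⟨ sum-cong-≗ (λ j → ∣p∣≡∣p∩∁q∣+∣p∩q∣ (A j) (⁅ i ↦ x ⁆ j)) ⟩
  ∑[ j < m ] (∣ (A ∖[ i , x ]) j ∣ + ∣ A j ∩ ⁅ i ↦ x ⁆ j ∣)
    ≡⟨ ∑-distrib-+ (λ j → ∣ (A ∖[ i , x ]) j ∣) (λ j → ∣ A j ∩ ⁅ i ↦ x ⁆ j ∣) ⟩
  size (A ∖[ i , x ]) + ∑[ j < m ] ∣ A j ∩ ⁅ i ↦ x ⁆ j ∣
    ≡⟨ cong (size (A ∖[ i , x ]) +_) deleted-once ⟩
  size (A ∖[ i , x ]) + 1
    ≡⟨ +-comm (size (A ∖[ i , x ])) 1 ⟩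
  suc (size (A ∖[ i , x ])) ∎
  where
  open ≡-Reasoning
  nothing-deleted-off-i : ∀ j → j ≢ i → ∀ y → y ∉ A j ∩ ⁅ i ↦ x ⁆ j
  nothing-deleted-off-i j j≢i y y∈ =
    j≢i (toWitness (proj₁ (x∈p∩q⁻ (λ _ → ⌊ j ≟ i ⌋) ⁅ x ⁆ (proj₂ (x∈p∩q⁻ (A j) (⁅ i ↦ x ⁆ j) y∈)))))
  deleted-once : ∑[ j < m ] ∣ A j ∩ ⁅ i ↦ x ⁆ j ∣ ≡ 1
  deleted-once = begin
    ∑[ j < m ] ∣ A j ∩ ⁅ i ↦ x ⁆ j ∣ ≡⟨ ∑-single i (λ j j≢i → empty⇒∣p∣≡0 (nothing-deleted-off-i j j≢i)) ⟩
    ∣ A i ∩ ⁅ i ↦ x ⁆ i ∣            ≡⟨ ∣∣-cong (λ y → cong (λ b → A i y ∧ (b ∧ ⌊ y ≟ x ⌋)) (Equivalence.to T-≡ (x∈⁅x⁆ i))) ⟩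
    ∣ A i ∩ ⁅ x ⁆ ∣                  ≡⟨ ∣p∩⁅a⁆∣≡χ[p[a]] (A i) x ⟩
    χ (A i x)                       ≡⟨ χ-true x∈Ai ⟩
    1                               ∎

module _ {A : Family m N} (hall : HallCondition A) {i : Fin m} where

  violator-contains : ∀ {x I} → ∣ ⋃ (A ∖[ i , x ]) I ∣ < ∣ I ∣ → i ∈ I
  violator-contains {x} {I} violated with T? (I i)
  ... | yes i∈I = i∈I
  ... | no  i∉I = contradiction (≤-trans (hall I) (p⊆q⇒∣p∣≤∣q∣ unaffected)) (<⇒≱ violated)
    where
    unaffected : ⋃ A I ⊆ ⋃ (A ∖[ i , x ]) I
    unaffected z z∈⋃ = let j , j∈I , z∈Aj = ∈⋃⁻ A I z∈⋃ in
      ∈⋃⁺ (A ∖[ i , x ]) I j∈I (∈∖⁺ A i x z∈Aj (inj₁ λ { refl → i∉I j∈I }))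

  -- Violators I and J of the two deletions would both contain i, and Hall's condition for
  -- I ∪ J and (I ∩ J) - i would give ∣ I ∣ + ∣ J ∣ ≤ ∣ P ∣ + ∣ Q ∣ + 1 for their deleted neighbourhoods P and Q.
  hallCondition-∖ : ∀ {x y} → x ≢ y → HallCondition (A ∖[ i , x ]) ⊎ HallCondition (A ∖[ i , y ])
  hallCondition-∖ {x} {y} x≢y
    with hallCondition-or-violator (A ∖[ i , x ]) | hallCondition-or-violator (A ∖[ i , y ])
  ... | inj₁ hallₓ            | _                     = inj₁ hallₓ
  ... | inj₂ _                | inj₁ hallᵧ            = inj₂ hallᵧ
  ... | inj₂ (I , I-violated) | inj₂ (J , J-violated) = contradiction (≤-trans violations counting) (n≮n _)
    where
    P Q : FinSet N
    P = ⋃ (A ∖[ i , x ]) I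
    Q = ⋃ (A ∖[ i , y ]) J
    i∈I : i ∈ I
    i∈I = violator-contains I-violated
    i∈J : i ∈ J
    i∈J = violator-contains J-violated

    counting : ∣ I ∣ + ∣ J ∣ ≤ suc (∣ P ∣ + ∣ Q ∣)
    counting = begin
      ∣ I ∣ + ∣ J ∣                 ≡⟨ ∣p∪q∣+∣p∩q∣≡∣p∣+∣q∣ I J ⟨
      ∣ I ∪ J ∣ + ∣ I ∩ J ∣         ≡⟨ cong (∣ I ∪ J ∣ +_) (x∈p⇒∣p∣≡1+∣p-x∣ (I ∩ J) (x∈p∩q⁺ I J (i∈I , i∈J))) ⟩
      ∣ I ∪ J ∣ + suc ∣ (I ∩ J) - i ∣ ≤⟨ +-mono-≤ hall-∪ (s≤s hall-∩) ⟩
      ∣ P ∪ Q ∣ + suc ∣ P ∩ Q ∣     ≡⟨ +-suc ∣ P ∪ Q ∣ ∣ P ∩ Q ∣ ⟩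
      suc (∣ P ∪ Q ∣ + ∣ P ∩ Q ∣)   ≡⟨ cong suc (∣p∪q∣+∣p∩q∣≡∣p∣+∣q∣ P Q) ⟩
      suc (∣ P ∣ + ∣ Q ∣)           ∎
      where
      open ≤-Reasoning
      hall-∪ : ∣ I ∪ J ∣ ≤ ∣ P ∪ Q ∣
      hall-∪ = ≤-trans (hall (I ∪ J)) (p⊆q⇒∣p∣≤∣q∣ (⋃[I∪J]⊆⋃∖[I]∪⋃∖[J] A i {I = I} {J} x≢y i∈I i∈J))
      hall-∩ : ∣ (I ∩ J) - i ∣ ≤ ∣ P ∩ Q ∣
      hall-∩ = ≤-trans (hall ((I ∩ J) - i)) (p⊆q⇒∣p∣≤∣q∣ (⋃[I∩J-i]⊆⋃∖[I]∩⋃∖[J] A i {x} {y} {I} {J}))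

    violations : suc (suc (∣ P ∣ + ∣ Q ∣)) ≤ ∣ I ∣ + ∣ J ∣
    violations = subst (_≤ ∣ I ∣ + ∣ J ∣) (cong suc (+-suc ∣ P ∣ ∣ Q ∣)) (+-mono-≤ I-violated J-violated)

transversal-mono : {A B : Family m N} → (∀ i → B i ⊆ A i) → Transversal B → Transversal A
transversal-mono B⊆A (σ , σ∈B , σ-inj) = σ , (λ i → B⊆A i (σ i) (σ∈B i)) , σ-inj

hallCondition⇒transversal-≤1 : (A : Family m N) → HallCondition A → (∀ i → ∣ A i ∣ ≤ 1) → Transversal A
hallCondition⇒transversal-≤1 {m} {N} A hall ∣A∣≤1 = σ , σ∈A , σ-inj
  where
  open ≤-Reasoning

  nonempty : ∀ i → ∃ (_∈ A i)
  nonempty i = 0<∣p∣⇒nonempty (A i) (begin-strict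
    0              <⟨ s≤s z≤n ⟩
    1              ≡⟨ ∣⁅a⁆∣≡1 i ⟨
    ∣ ⁅ i ⁆ ∣       ≤⟨ hall ⁅ i ⁆ ⟩
    ∣ ⋃ A ⁅ i ⁆ ∣   ≤⟨ p⊆q⇒∣p∣≤∣q∣ ⋃⁅i⁆⊆Ai ⟩
    ∣ A i ∣         ∎)
    where
    ⋃⁅i⁆⊆Ai : ⋃ A ⁅ i ⁆ ⊆ A i
    ⋃⁅i⁆⊆Ai z z∈⋃ = let j , j∈⁅i⁆ , z∈Aj = ∈⋃⁻ A ⁅ i ⁆ z∈⋃ in subst (λ j → z ∈ A j) (x∈⁅y⁆⇒x≡y j∈⁅i⁆) z∈Aj

  σ : Fin m → Fin N
  σ = proj₁ ∘ nonempty
  σ∈A : ∀ i → σ i ∈ A i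
  σ∈A = proj₂ ∘ nonempty

  only-σ : ∀ {j z} → z ∈ A j → z ≡ σ j
  only-σ {j} z∈Aj = ∣p∣≤1⇒x≡y (A j) (∣A∣≤1 j) z∈Aj (σ∈A j)

  σ-inj : Injective _≡_ _≡_ σ
  σ-inj {i} {j} σi≡σj with i ≟ j
  ... | yes i≡j = i≡j
  ... | no  i≢j = contradiction (begin-strict
    1                          <⟨ distinct⇒1<∣p∣ (⁅ i ⁆ ∪ ⁅ j ⁆) (x∈p∪q⁺ ⁅ i ⁆ ⁅ j ⁆ (inj₁ (x∈⁅x⁆ i)))
                                                (x∈p∪q⁺ ⁅ i ⁆ ⁅ j ⁆ (inj₂ (x∈⁅x⁆ j))) i≢j ⟩
    ∣ ⁅ i ⁆ ∪ ⁅ j ⁆ ∣           ≤⟨ hall (⁅ i ⁆ ∪ ⁅ j ⁆) ⟩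
    ∣ ⋃ A (⁅ i ⁆ ∪ ⁅ j ⁆) ∣     ≤⟨ p⊆q⇒∣p∣≤∣q∣ ⋃⁅i,j⁆⊆⁅σi⁆ ⟩
    ∣ ⁅ σ i ⁆ ∣                 ≡⟨ ∣⁅a⁆∣≡1 (σ i) ⟩
    1                          ∎) (n≮n 1)
    where
    ⋃⁅i,j⁆⊆⁅σi⁆ : ⋃ A (⁅ i ⁆ ∪ ⁅ j ⁆) ⊆ ⁅ σ i ⁆
    ⋃⁅i,j⁆⊆⁅σi⁆ z z∈⋃ with ∈⋃⁻ A (⁅ i ⁆ ∪ ⁅ j ⁆) z∈⋃
    ... | l , l∈⁅i,j⁆ , z∈Al with x∈p∪q⁻ ⁅ i ⁆ ⁅ j ⁆ l∈⁅i,j⁆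
    ...   | inj₁ l∈⁅i⁆ = fromWitness (trans (only-σ z∈Al) (cong σ (x∈⁅y⁆⇒x≡y l∈⁅i⁆)))
    ...   | inj₂ l∈⁅j⁆ = fromWitness (trans (only-σ z∈Al) (trans (cong σ (x∈⁅y⁆⇒x≡y l∈⁅j⁆)) (sym σi≡σj)))

hallCondition⇒transversal-size≤ : ∀ s (A : Family m N) → size A ≤ s → HallCondition A → Transversal A
hallCondition⇒transversal-size≤ s A size≤s hall with any? (λ i → 1 <? ∣ A i ∣)
... | no  ∄large = hallCondition⇒transversal-≤1 A hall (λ i → ≮⇒≥ (∄large ∘ (i ,_)))
... | yes (i , 1<∣Ai∣) with 1<∣p∣⇒distinct (A i) 1<∣Ai∣
...   | x , y , x∈Ai , y∈Ai , x≢y =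
  Sum.[ shrink s size≤s x∈Ai , shrink s size≤s y∈Ai ]′ (hallCondition-∖ hall x≢y)
  where
  shrink : ∀ t {w} → size A ≤ t → w ∈ A i → HallCondition (A ∖[ i , w ]) → Transversal A
  shrink t size≤t w∈Ai hall′ with subst (_≤ t) (size-∖ A w∈Ai) size≤t
  shrink (suc t) _ w∈Ai hall′ | s≤s size′≤t =
    transversal-mono (∖-⊆ A i _) (hallCondition⇒transversal-size≤ t (A ∖[ i , _ ]) size′≤t hall′)

hallCondition⇒transversal : (A : Family m N) → HallCondition A → Transversal A
hallCondition⇒transversal A = hallCondition⇒transversal-size≤ (size A) A ≤-refl

uniform⇒hallCondition : (A : Family m N) (d : ℕ) .{{_ : NonZero d}} →
                        (∀ i → ∣ A i ∣ ≡ d) → (∀ x → ∣ (λ i → A i x) ∣ ≤ d) → HallCondition A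
uniform⇒hallCondition {m} {N} A d ∣Ai∣≡d ∣Aˣ∣≤d I = *-cancelʳ-≤ ∣ I ∣ ∣ ⋃ A I ∣ d (begin
  ∣ I ∣ * d                                   ≡⟨ *-distribʳ-sum d (χ ∘ I) ⟩
  ∑[ i < m ] (χ (I i) * d)                    ≡⟨ sum-cong-≗ (λ i → cong (χ (I i) *_) (∣Ai∣≡d i)) ⟨
  ∑[ i < m ] (χ (I i) * ∣ A i ∣)              ≡⟨ sum-cong-≗ (λ i → *-distribˡ-sum (χ (I i)) (χ ∘ A i)) ⟩
  ∑[ i < m ] ∑[ x < N ] (χ (I i) * χ (A i x)) ≡⟨ ∑-comm (λ i x → χ (I i) * χ (A i x)) ⟩
  ∑[ x < N ] ∑[ i < m ] (χ (I i) * χ (A i x)) ≡⟨ sum-cong-≗ (λ x → sum-cong-≗ (λ i → χ-∧ (I i) (A i x))) ⟨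
  ∑[ x < N ] ∣ I ∩ column x ∣                 ≤⟨ ∑-mono-≤ column-bound ⟩
  ∑[ x < N ] (χ (⋃ A I x) * d)                ≡⟨ *-distribʳ-sum d (χ ∘ ⋃ A I) ⟨
  ∣ ⋃ A I ∣ * d                               ∎)
  where
  open ≤-Reasoning
  column : Fin N → FinSet m
  column x i = A i x
  column-bound : ∀ x → ∣ I ∩ column x ∣ ≤ χ (⋃ A I x) * d
  column-bound x with T? (⋃ A I x)
  ... | yes x∈⋃ = begin
    ∣ I ∩ column x ∣   ≤⟨ p⊆q⇒∣p∣≤∣q∣ (λ i → proj₂ ∘ x∈p∩q⁻ I (column x) {i}) ⟩
    ∣ column x ∣       ≤⟨ ∣Aˣ∣≤d x ⟩
    d                  ≡⟨ *-identityˡ d ⟨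
    1 * d              ≡⟨ cong (_* d) (χ-true x∈⋃) ⟨
    χ (⋃ A I x) * d    ∎
  ... | no x∉⋃ = subst (_≤ χ (⋃ A I x) * d) (sym (empty⇒∣p∣≡0 outside)) z≤n
    where
    outside : ∀ i → i ∉ I ∩ column x
    outside i i∈ = let i∈I , x∈Ai = x∈p∩q⁻ I (column x) i∈ in x∉⋃ (∈⋃⁺ A I i∈I x∈Ai)

length-filter-tabulate : (p : FinSet N) (g : Fin m → Fin N) →
                         length (filter (λ x → T? (p x)) (tabulate g)) ≡ ∣ p ∘ g ∣
length-filter-tabulate {m = zero}  p g = refl
length-filter-tabulate {m = suc m} p g with p (g zero)
... | true  = cong suc (length-filter-tabulate p (g ∘ suc))
... | false = length-filter-tabulate p (g ∘ suc)

degree≡∣adj∣ : (G : Graph n) (v : Fin n) → degree G v ≡ ∣ adj G v ∣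
degree≡∣adj∣ G v = length-filter-tabulate (adj G v) (λ x → x)

complement : Graph n → Graph n
complement G = record
  { adj    = λ u → ∁ (adj G u) - u
  ; sym    = λ u v → cong₂ _∧_ (cong not (Graph.sym G u v)) (cong not (⌊⌋-⇔ sym sym (v ≟ u) (u ≟ v)))
  ; irrefl = λ v → trans (cong (λ b → not (adj G v v) ∧ not b) (Equivalence.to T-≡ (x∈⁅x⁆ v))) (∧-zeroʳ _)
  }

complement-regular : (G : Graph n) → Regular r G → Regular (n ∸ suc r) (complement G)
complement-regular {n} {r} G G-regular v = begin
  degree (complement G) v              ≡⟨ degree≡∣adj∣ (complement G) v ⟩
  ∣ Nᶜ ∣                                ≡⟨ m+n∸m≡n (suc r) ∣ Nᶜ ∣ ⟨
  suc r + ∣ Nᶜ ∣ ∸ suc r                ≡⟨ cong (_∸ suc r) r+1+∣Nᶜ∣≡n ⟩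
  n ∸ suc r                            ∎
  where
  open ≡-Reasoning
  Nᶜ : FinSet n
  Nᶜ = ∁ (adj G v) - v
  v∈∁N[v] : v ∈ ∁ (adj G v)
  v∈∁N[v] = Equivalence.from T-not-≡ (Graph.irrefl G v)
  r+1+∣Nᶜ∣≡n : suc r + ∣ Nᶜ ∣ ≡ n
  r+1+∣Nᶜ∣≡n = begin
    suc r + ∣ Nᶜ ∣                  ≡⟨ +-suc r ∣ Nᶜ ∣ ⟨
    r + suc ∣ Nᶜ ∣                  ≡⟨ cong₂ _+_ (trans (sym (G-regular v)) (degree≡∣adj∣ G v))
                                                 (sym (x∈p⇒∣p∣≡1+∣p-x∣ (∁ (adj G v)) v∈∁N[v])) ⟩
    ∣ adj G v ∣ + ∣ ∁ (adj G v) ∣    ≡⟨ ∣p∣+∣∁p∣≡N (adj G v) ⟩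
    n                               ∎

_∪ᴳ_ : Graph n → Graph n → Graph n
G ∪ᴳ H = record
  { adj    = λ u → adj G u ∪ adj H u
  ; sym    = λ u v → cong₂ _∨_ (Graph.sym G u v) (Graph.sym H u v)
  ; irrefl = λ v → cong₂ _∨_ (Graph.irrefl G v) (Graph.irrefl H v)
  }

∪ᴳ-extends : (G H : Graph n) → Extends G (G ∪ᴳ H)
∪ᴳ-extends G H u v uv∈G = x∈p∪q⁺ (adj G u) (adj H u) (inj₁ uv∈G)

degree-∪ᴳ : (G H : Graph n) → (∀ u v → Adj G u v → ¬ Adj H u v) →
            ∀ v → degree (G ∪ᴳ H) v ≡ degree G v + degree H v
degree-∪ᴳ G H disjoint v = begin
  degree (G ∪ᴳ H) v                           ≡⟨ degree≡∣adj∣ (G ∪ᴳ H) v ⟩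
  ∣ adj G v ∪ adj H v ∣                        ≡⟨ +-identityʳ ∣ adj G v ∪ adj H v ∣ ⟨
  ∣ adj G v ∪ adj H v ∣ + 0                    ≡⟨ cong (∣ adj G v ∪ adj H v ∣ +_) (empty⇒∣p∣≡0 no-common-edge) ⟨
  ∣ adj G v ∪ adj H v ∣ + ∣ adj G v ∩ adj H v ∣ ≡⟨ ∣p∪q∣+∣p∩q∣≡∣p∣+∣q∣ (adj G v) (adj H v) ⟩
  ∣ adj G v ∣ + ∣ adj H v ∣                    ≡⟨ cong₂ _+_ (degree≡∣adj∣ G v) (degree≡∣adj∣ H v) ⟨
  degree G v + degree H v                     ∎
  where
  open ≡-Reasoning
  no-common-edge : ∀ w → w ∉ adj G v ∩ adj H v
  no-common-edge w vw∈G∩H = let vw∈G , vw∈H = x∈p∩q⁻ (adj G v) (adj H v) vw∈G∩H in disjoint v w vw∈G vw∈H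

module _ {μ : Fin n → Fin n} (μ-involutive : ∀ u → μ (μ u) ≡ u) (μ-fixpoint-free : ∀ u → μ u ≢ u) where

  matchingGraph : Graph n
  matchingGraph = record
    { adj    = λ u → ⁅ μ u ⁆
    ; sym    = λ u v → ⌊⌋-⇔ (swap u v) (swap v u) (v ≟ μ u) (u ≟ μ v)
    ; irrefl = λ v → Equivalence.to T-not-≡ (fromWitnessFalse (μ-fixpoint-free v ∘ sym))
    }
    where
    swap : ∀ u v → v ≡ μ u → u ≡ μ v
    swap u v v≡μu = trans (sym (μ-involutive u)) (cong μ (sym v≡μu))

  matchingGraph-regular : Regular 1 matchingGraph
  matchingGraph-regular v = trans (degree≡∣adj∣ matchingGraph v) (∣⁅a⁆∣≡1 (μ v))

  extend-by-matching : (G : Graph n) → Regular r G → (∀ u → ¬ Adj G u (μ u)) →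
                       Σ (Graph n) λ H → Extends G H × Regular (suc r) H
  extend-by-matching {r} G G-regular μ-non-adjacent =
    G ∪ᴳ matchingGraph , ∪ᴳ-extends G matchingGraph , λ v → begin
      degree (G ∪ᴳ matchingGraph) v              ≡⟨ degree-∪ᴳ G matchingGraph new-edges v ⟩
      degree G v + degree matchingGraph v        ≡⟨ cong₂ _+_ (G-regular v) (matchingGraph-regular v) ⟩
      r + 1                                      ≡⟨ +-comm r 1 ⟩
      suc r                                      ∎
    where
    open ≡-Reasoning
    new-edges : ∀ u v → Adj G u v → ¬ Adj matchingGraph u v
    new-edges u v uv∈G v≡μu = μ-non-adjacent u (subst (Adj G u) (x∈⁅y⁆⇒x≡y v≡μu) uv∈G)

image : (Fin k → Fin n) → FinSet n
image f u = ⌊ any? (λ i → u ≟ f i) ⌋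

k≤∣image∣ : {f : Fin k → Fin n} → Injective _≡_ _≡_ f → k ≤ ∣ image f ∣
k≤∣image∣ {f = f} f-inj =
  subst (_≤ ∣ image f ∣) (full⇒∣p∣≡N (image f ∘ f) (λ i → fromWitness (i , refl))) (∣p∘f∣≤∣p∣ f-inj (image f))

module ImagePairing {f g : Fin k → Fin n} (n≡k+k : n ≡ k + k)
                    (f-inj : Injective _≡_ _≡_ f) (g-inj : Injective _≡_ _≡_ g) (f≢g : ∀ i j → f i ≢ g j) where

  disjoint-images-cover : ∀ u → (∃ λ i → u ≡ f i) ⊎ (∃ λ i → u ≡ g i)
  disjoint-images-cover u with T? ((image f ∪ image g) u)
  ... | yes u∈F∪G = Sum.map toWitness toWitness (x∈p∪q⁻ (image f) (image g) u∈F∪G)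
  ... | no  u∉F∪G = contradiction (begin-strict
    n                                            ≡⟨ n≡k+k ⟩
    k + k                                        ≤⟨ +-mono-≤ (k≤∣image∣ f-inj) (k≤∣image∣ g-inj) ⟩
    ∣ image f ∣ + ∣ image g ∣                     ≡⟨ ∣p∪q∣+∣p∩q∣≡∣p∣+∣q∣ (image f) (image g) ⟨
    ∣ image f ∪ image g ∣ + ∣ image f ∩ image g ∣ ≡⟨ cong (∣ image f ∪ image g ∣ +_) (empty⇒∣p∣≡0 disjoint) ⟩
    ∣ image f ∪ image g ∣ + 0                     <⟨ +-monoʳ-< ∣ image f ∪ image g ∣ (x∈p⇒0<∣p∣ (∁ (image f ∪ image g)) u∈∁[F∪G]) ⟩
    ∣ image f ∪ image g ∣ + ∣ ∁ (image f ∪ image g) ∣ ≡⟨ ∣p∣+∣∁p∣≡N (image f ∪ image g) ⟩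
    n                                            ∎) (n≮n n)
    where
    open ≤-Reasoning
    u∈∁[F∪G] : u ∈ ∁ (image f ∪ image g)
    u∈∁[F∪G] = T-not⁺ u∉F∪G
    disjoint : ∀ v → v ∉ image f ∩ image g
    disjoint v v∈F∩G with x∈p∩q⁻ (image f) (image g) v∈F∩G
    ... | v∈F , v∈G = let i , v≡fi = toWitness v∈F ; j , v≡gj = toWitness v∈G in f≢g i j (trans (sym v≡fi) v≡gj)

  partner : Fin n → Fin n
  partner u = Sum.[ g ∘ proj₁ , f ∘ proj₁ ]′ (disjoint-images-cover u)

  partner-pairs : ∀ u → (∃ λ i → u ≡ f i × partner u ≡ g i) ⊎ (∃ λ i → u ≡ g i × partner u ≡ f i)
  partner-pairs u with disjoint-images-cover u
  ... | inj₁ (i , u≡fi) = inj₁ (i , u≡fi , refl)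
  ... | inj₂ (i , u≡gi) = inj₂ (i , u≡gi , refl)

  partner-f : ∀ i → partner (f i) ≡ g i
  partner-f i with disjoint-images-cover (f i)
  ... | inj₁ (j , fi≡fj) = cong g (f-inj (sym fi≡fj))
  ... | inj₂ (j , fi≡gj) = contradiction fi≡gj (f≢g i j)

  partner-g : ∀ i → partner (g i) ≡ f i
  partner-g i with disjoint-images-cover (g i)
  ... | inj₁ (j , gi≡fj) = contradiction (sym gi≡fj) (f≢g j i)
  ... | inj₂ (j , gi≡gj) = cong f (g-inj (sym gi≡gj))

  partner-involutive : ∀ u → partner (partner u) ≡ u
  partner-involutive u with disjoint-images-cover u
  ... | inj₁ (i , u≡fi) = trans (partner-g i) (sym u≡fi)
  ... | inj₂ (i , u≡gi) = trans (partner-f i) (sym u≡gi)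

Adj-sym : (G : Graph n) {u v : Fin n} → Adj G u v → Adj G v u
Adj-sym G {u} {v} = subst T (Graph.sym G u v)

Adj-complement⁻ : (G : Graph n) {u v : Fin n} → Adj (complement G) u v → ¬ Adj G u v × v ≢ u
Adj-complement⁻ G {u} uv∈Gᶜ = T-not⁻ (x∈p-y⇒x∈p (∁ (adj G u)) uv∈Gᶜ) , x∈p-y⇒x≢y (∁ (adj G u)) uv∈Gᶜ

1+m≤n∸1⇒1+m<n : ∀ {m} → suc m ≤ n ∸ 1 → suc m < n
1+m≤n∸1⇒1+m<n {suc n} = s≤s

non-neighbour-transversal : (G : Graph n) → Regular r G → suc r ≤ n ∸ 1 →
                            {f : Fin k → Fin n} → Injective _≡_ _≡_ f →
                            Transversal (λ i → adj (complement G) (f i))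
non-neighbour-transversal {n} {r} {k} G G-regular r+1≤n-1 {f} f-inj =
  hallCondition⇒transversal A (uniform⇒hallCondition A d ∣Ai∣≡d ∣Aˣ∣≤d)
  where
  Gᶜ : Graph n
  Gᶜ = complement G
  d : ℕ
  d = n ∸ suc r
  instance
    d-nonZero : NonZero d
    d-nonZero = >-nonZero (m<n⇒0<n∸m {suc r} {n} (1+m≤n∸1⇒1+m<n r+1≤n-1))
  A : Family k n
  A i = adj Gᶜ (f i)
  ∣Nᶜ∣≡d : ∀ v → ∣ adj Gᶜ v ∣ ≡ d
  ∣Nᶜ∣≡d v = trans (sym (degree≡∣adj∣ Gᶜ v)) (complement-regular G G-regular v)
  ∣Ai∣≡d : ∀ i → ∣ A i ∣ ≡ d
  ∣Ai∣≡d i = ∣Nᶜ∣≡d (f i)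
  ∣Aˣ∣≤d : ∀ x → ∣ (λ i → A i x) ∣ ≤ d
  ∣Aˣ∣≤d x = begin
    ∣ (λ i → A i x) ∣   ≡⟨ ∣∣-cong (λ i → Graph.sym Gᶜ (f i) x) ⟩
    ∣ adj Gᶜ x ∘ f ∣    ≤⟨ ∣p∘f∣≤∣p∣ f-inj (adj Gᶜ x) ⟩
    ∣ adj Gᶜ x ∣        ≡⟨ ∣Nᶜ∣≡d x ⟩
    d                  ∎
    where open ≤-Reasoning

extend-along-transversal : n ≡ k + k → (G : Graph n) → Regular r G → (K : ContainsComplete k G) →
                           Transversal (λ i → adj (complement G) (proj₁ K i)) →
                           Σ (Graph n) λ H → Extends G H × Regular (suc r) H
extend-along-transversal n≡k+k G G-regular (f , f-inj , f-clique) (σ , σ∈Nᶜ , σ-inj) =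
  extend-by-matching partner-involutive partner-fixpoint-free G G-regular partner-non-adjacent
  where
  σ-non-adjacent : ∀ i → ¬ Adj G (f i) (σ i)
  σ-non-adjacent i = proj₁ (Adj-complement⁻ G (σ∈Nᶜ i))

  σ≢f : ∀ i → σ i ≢ f i
  σ≢f i = proj₂ (Adj-complement⁻ G (σ∈Nᶜ i))

  f≢σ : ∀ i j → f i ≢ σ j
  f≢σ i j fi≡σj with i ≟ j
  ... | yes refl = σ≢f i (sym fi≡σj)
  ... | no  i≢j  = σ-non-adjacent j (subst (Adj G (f j)) fi≡σj (f-clique j i (i≢j ∘ sym)))

  open ImagePairing n≡k+k f-inj σ-inj f≢σ

  partner-fixpoint-free : ∀ u → partner u ≢ u
  partner-fixpoint-free u pu≡u =
    Sum.[ (λ (i , u≡fi , pu≡σi) → σ≢f i (trans (sym pu≡σi) (trans pu≡u u≡fi)))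
        , (λ (i , u≡σi , pu≡fi) → σ≢f i (trans (sym u≡σi) (trans (sym pu≡u) pu≡fi)))
        ]′ (partner-pairs u)

  partner-non-adjacent : ∀ u → ¬ Adj G u (partner u)
  partner-non-adjacent u upu∈G =
    Sum.[ (λ (i , u≡fi , pu≡σi) → σ-non-adjacent i (subst₂ (Adj G) u≡fi pu≡σi upu∈G))
        , (λ (i , u≡σi , pu≡fi) → σ-non-adjacent i (Adj-sym G (subst₂ (Adj G) u≡σi pu≡fi upu∈G)))
        ]′ (partner-pairs u)

extend-regular-suc : n ≡ k + k → (G : Graph n) → Regular r G → ContainsComplete k G → suc r ≤ n ∸ 1 →
                     Σ (Graph n) λ H → Extends G H × Regular (suc r) H
extend-regular-suc n≡k+k G G-regular K@(_ , f-inj , _) r+1≤n-1 =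
  extend-along-transversal n≡k+k G G-regular K (non-neighbour-transversal G G-regular r+1≤n-1 f-inj)

ContainsComplete-mono : {G H : Graph n} → Extends G H → ContainsComplete k G → ContainsComplete k H
ContainsComplete-mono G⊆H (f , f-inj , f-clique) = f , f-inj , λ i j i≢j → G⊆H (f i) (f j) (f-clique i j i≢j)

extend-regular : ∀ {r′} → n ≡ k + k → (G : Graph n) → Regular r G → ContainsComplete k G →
                 r ≤′ r′ → r′ ≤ n ∸ 1 → Σ (Graph n) λ H → Extends G H × Regular r′ H
extend-regular n≡k+k G G-regular K (≤′-reflexive refl) _ = G , (λ _ _ uv∈G → uv∈G) , G-regular
extend-regular n≡k+k G G-regular K (≤′-step r≤′r′) r′+1≤n-1 =
  let H  , G⊆H  , H-regular  = extend-regular n≡k+k G G-regular K r≤′r′ (≤-trans (n≤1+n _) r′+1≤n-1)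
      K′                     = ContainsComplete-mono {G = G} {H} G⊆H K
      H′ , H⊆H′ , H′-regular = extend-regular-suc n≡k+k H H-regular K′ r′+1≤n-1
  in H′ , (λ u v → H⊆H′ u v ∘ G⊆H u v) , H′-regular

mainTheorem8 : (n k r : ℕ) → n ≡ k + k → (G : Graph n) → Regular r G → k ≤ r →
    ContainsComplete k G →
    (r′ : ℕ) → r ≤ r′ → r′ ≤ n ∸ 1 →
    Σ (Graph n) λ H → Extends G H × Regular r′ H
mainTheorem8 n k r n≡k+k G G-regular _ K r′ r≤r′ r′≤n-1 =
  extend-regular n≡k+k G G-regular K (≤⇒≤′ r≤r′) r′≤n-1
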